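{- For every integer $n\ge7$, the complete wheel $W_n$ is not a willow.
   Context: For $n\ge3$, $W_n$ is the $(n+1)$-vertex graph with a vertex $c$ (the center) adjacent to all other vertices such that $W_n\setminus c$ is the cycle $C_n$. For a positive integer $m$, a graph $G$ is an $m$-willow if there exists an oriented tree $T$ with $V(G)\subseteq V(T)$ such that for all distinct $u,v\in V(G)$, $u$ and $v$ are adjacent in $G$ if and only if $T$ has a directed path from $u$ to $v$ or from $v$ to $u$ whose length is not a multiple of $m$. A willow is a graph that is an $m$-willow for some positive integer $m$. -}

module Defs where

open import Data.Empty using (⊥)
open import Data.Unit using (⊤)
open import Data.Nat using (ℕ; zero; suc; _≥_)
open import Data.Nat.Divisibility using (_∣_)
open import Data.Fin using (Fin; zero; suc; toℕ; inject₁; fromℕ)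
open import Data.Product using (Σ; ∃; _×_; _,_)
open import Data.Sum using (_⊎_)
open import Relation.Nullary using (¬_)
open import Relation.Binary.PropositionalEquality using (_≡_; _≢_)
open import Function.Definitions using (Injective)
open import Function.Bundles using (_⇔_)

Rel : ℕ → Set₁
Rel k = Fin k → Fin k → Set

record Path {k : ℕ} (R : Rel k) (u v : Fin k) (L : ℕ) : Set where
  field
    vert     : Fin (suc L) → Fin k
    start    : vert zero ≡ u
    end      : vert (fromℕ L) ≡ v
    step     : (i : Fin L) → R (vert (inject₁ i)) (vert (suc i))
    distinct : Injective _≡_ _≡_ vert

record Cycle {k : ℕ} (R : Rel k) : Set where
  field
    len      : ℕ
    vert     : Fin (suc (suc (suc len))) → Fin k
    step     : (i : Fin (suc (suc len))) → R (vert (inject₁ i)) (vert (suc i))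
    close    : R (vert (fromℕ (suc (suc len)))) (vert zero)
    distinct : Injective _≡_ _≡_ vert

Underlying : {k : ℕ} → Rel k → Rel k
Underlying A x y = A x y ⊎ A y x

IsOriented : {k : ℕ} → Rel k → Set
IsOriented A = (∀ x → ¬ A x x) × (∀ x y → A x y → ¬ A y x)

IsTree : {k : ℕ} → Rel k → Set
IsTree E = (∀ x y → ∃ λ L → Path E x y L) × ¬ Cycle E

IsOrientedTree : {k : ℕ} → Rel k → Set
IsOrientedTree A = IsOriented A × IsTree (Underlying A)

IsMWillow : (m : ℕ) {V : Set} (Adj : V → V → Set) → Set₁
IsMWillow m {V} Adj =
  Σ ℕ λ k → Σ (Rel k) λ A → Σ (V → Fin k) λ f →
    IsOrientedTree A × Injective _≡_ _≡_ f ×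
    (∀ u v → u ≢ v →
      Adj u v ⇔ (∃ λ L → (Path A (f u) (f v) L ⊎ Path A (f v) (f u) L) × ¬ (m ∣ L)))

IsWillow : {V : Set} (Adj : V → V → Set) → Set₁
IsWillow Adj = Σ ℕ λ m → m ≥ 1 × IsMWillow m Adj

-- The wheel W_n on vertex set Fin (suc n): vertex zero is the center c,
-- vertices suc i (i : Fin n) form the cycle C_n, with i adjacent to i+1 mod n.

SuccMod : (n : ℕ) → Fin n → Fin n → Set
SuccMod n i j = (toℕ j ≡ suc (toℕ i)) ⊎ (suc (toℕ i) ≡ n × toℕ j ≡ 0)

CycleAdj : (n : ℕ) → Fin n → Fin n → Set
CycleAdj n i j = SuccMod n i j ⊎ SuccMod n j i

WheelAdj : (n : ℕ) → Fin (suc n) → Fin (suc n) → Set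
WheelAdj n zero    zero    = ⊥
WheelAdj n zero    (suc j) = ⊤
WheelAdj n (suc i) zero    = ⊤
WheelAdj n (suc i) (suc j) = CycleAdj n i j

{-# OPTIONS --safe #-}
-- Fix an m-willow representation of W_n and let c be the image of the centre. Each rim vertex x is
-- joined to c by a directed path whose length d x is not divisible by m; let h x be d x if x lies
-- below c and -d x if it lies above. Since paths in a tree are unique, a directed path between rim
-- vertices x, y has length |h x - h y|; so for x ≈ y :⇔ m ∣ h x - h y, rim neighbours are never
-- equivalent, while non-neighbours on opposite sides of c are (their path runs through c).
-- If the side changes between consecutive rim vertices v₀, v₁, each of v₃, v₄, v₅ is equivalent to
-- whichever of v₀, v₁ lies on its other side; these classes must alternate, and then v₂ or v₆
-- makes two rim neighbours equivalent. If all rim vertices lie on one side, let v₂ have maximal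
-- depth: v₁ and v₃ both reach v₂, so they are comparable, and being non-neighbours, equivalent.
-- Then v₀ becomes comparable with v₃ (or v₄ with v₁) and inequivalent to it, hence adjacent.
module Submission where

open import Defs
open import Data.Nat as ℕ using (ℕ; zero; suc; _+_; _*_; _∸_; _≤_; _<_; _≥_; _≤?_; z≤n; s≤s; NonZero; >-nonZero)
open import Data.Nat.Properties
  using (+-comm; +-assoc; +-cancelʳ-≡; +-cancelˡ-<; *-cancelʳ-<; +-monoˡ-≤; +-monoˡ-<; ≤-trans; ≤-antisym; <-trans;
         <-irrefl; <⇒≤; <⇒≱; n<1+n; m≤n+m; m<m+n; m<n+m; m<1+n⇒m≤n; m≤n⇒m<n∨m≡n; m+[n∸m]≡n)
open import Data.Nat.DivMod using (_%_; _/_; _mod_; m≡m%n+[m/n]*n; [m+kn]%n≡m%n; [m+n]%n≡m%n; m<n⇒m%n≡m; n%n≡0; m%n<n; /-monoˡ-≤)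
open import Data.Nat.Divisibility using (_∣_; _∣?_)
open import Data.Integer as ℤ using (ℤ; +_; -_; _-_)
import Data.Integer.Divisibility.Signed as ℤ
open import Data.Integer.Properties using (pos-+)
open import Data.Integer.Tactic.RingSolver using (solve-∀)
open import Data.Bool using (Bool; true; false)
open import Data.Bool.Properties using (¬-not) renaming (_≟_ to _≟ᵇ_)
open import Data.Fin using (Fin; zero; suc; toℕ; inject₁; fromℕ; _≟_)
open import Data.Fin.Properties using (suc-injective; toℕ-fromℕ<; toℕ-injective; toℕ<n; all?; ¬∀⟶∃¬)
open import Data.List using (List; []; _∷_; _++_; [_]; length; tabulate; lookup; allFin)
open import Data.List.Properties using (length-++; length-tabulate; ∷-injective)
open import Data.List.Extrema.Nat using (argmax; f[xs]≤f[argmax])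
open import Data.List.Membership.Propositional using (_∈_; _∉_)
open import Data.List.Membership.Propositional.Properties using (∈-++⁺ˡ; ∈-++⁻; ∈-tabulate⁻; ∈-allFin; ∈-lookup)
open import Data.List.Relation.Unary.Any using (here; there; any?)
import Data.List.Relation.Unary.All as All
open import Data.Unit using (tt)
open import Data.Product using (∃; ∃-syntax; _×_; _,_; proj₁; proj₂; map₁)
open import Data.Sum using (_⊎_; inj₁; inj₂; swap; [_,_]′)
open import Data.Empty using (⊥; ⊥-elim)
open import Relation.Nullary using (¬_; yes; no)
open import Relation.Nullary.Decidable using (True; toWitness)
open import Relation.Binary.Definitions using (Symmetric; Transitive)
open import Relation.Binary.PropositionalEquality using (_≡_; _≢_; refl; sym; trans; cong; subst; subst₂; module ≡-Reasoning)
open import Function.Base using (_∘_; flip)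
open import Function.Definitions using (Injective)
open import Function.Bundles using (_⇔_; mk⇔; Equivalence)

Reach : {k : ℕ} → Rel k → Rel k
Reach R a b = ∃[ L ] Path R a b L

module _ {k : ℕ} where

  -- The list index holds the vertices visited after the start.
  data Walk (R : Rel k) : Fin k → List (Fin k) → Fin k → Set where
    ε   : ∀ {a} → Walk R a [] a
    _◅_ : ∀ {a b xs c} → R a b → Walk R b xs c → Walk R a (b ∷ xs) c

  infixr 5 _◅_ _◅◅_

  data Distinct : List (Fin k) → Set where
    []  : Distinct []
    _∷_ : ∀ {x xs} → x ∉ xs → Distinct xs → Distinct (x ∷ xs)

  private
    variable
      R S : Rel k
      a b c : Fin k
      xs ys : List (Fin k)

  _◅◅_ : Walk R a xs b → Walk R b ys c → Walk R a (xs ++ ys) c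
  ε        ◅◅ w₂ = w₂
  (r ◅ w₁) ◅◅ w₂ = r ◅ (w₁ ◅◅ w₂)

  splitWalk : ∀ xs → Walk R a (xs ++ ys) c → ∃[ b ] Walk R a xs b × Walk R b ys c
  splitWalk []       w       = _ , ε , w
  splitWalk (x ∷ xs) (r ◅ w) with splitWalk xs w
  ... | b , w₁ , w₂ = b , r ◅ w₁ , w₂

  end-unique : ∀ {b′} → Walk R a xs b → Walk R a xs b′ → b ≡ b′
  end-unique ε       ε        = refl
  end-unique (_ ◅ w) (_ ◅ w′) = end-unique w w′

  end∈ : Walk R a xs b → b ∈ a ∷ xs
  end∈ ε       = here refl
  end∈ (_ ◅ w) = there (end∈ w)

  mapWalk : (∀ {x y} → R x y → S x y) → Walk R a xs b → Walk S a xs b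
  mapWalk g ε       = ε
  mapWalk g (r ◅ w) = g r ◅ mapWalk g w

  _▻_ : Walk R a xs b → R b c → Walk R a (xs ++ [ c ]) c
  ε       ▻ r = r ◅ ε
  (s ◅ w) ▻ r = s ◅ (w ▻ r)

  backtrack : Fin k → List (Fin k) → List (Fin k)
  backtrack a []       = []
  backtrack a (x ∷ xs) = backtrack x xs ++ [ a ]

  reverseWalk : Walk R a xs b → Walk (flip R) b (backtrack a xs) a
  reverseWalk ε       = ε
  reverseWalk (r ◅ w) = reverseWalk w ▻ r

  ∈-backtrack : ∀ a xs {y} → y ∈ backtrack a xs → y ∈ a ∷ xs
  ∈-backtrack a []       ()
  ∈-backtrack a (x ∷ xs) p with ∈-++⁻ (backtrack x xs) p
  ... | inj₁ q         = there (∈-backtrack x xs q)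
  ... | inj₂ (here refl) = here refl

  prefixTo : Walk R a xs b → c ∈ a ∷ xs →
             ∃[ ys ] Walk R a ys c × ∃[ rest ] xs ≡ ys ++ rest
  prefixTo {xs = xs} w       (here refl) = [] , ε , xs , refl
  prefixTo           (r ◅ w) (there p) with prefixTo w p
  ... | ys , w′ , rest , refl = _ ∷ ys , r ◅ w′ , rest , refl

  distinct-++ˡ : ∀ xs → Distinct (xs ++ ys) → Distinct xs
  distinct-++ˡ []       _       = []
  distinct-++ˡ (x ∷ xs) (x∉ ∷ d) = (λ p → x∉ (∈-++⁺ˡ p)) ∷ distinct-++ˡ xs d

  distinct-++ : ∀ xs → Distinct xs → Distinct ys → (∀ {y} → y ∈ ys → y ∉ xs) → Distinct (xs ++ ys)
  distinct-++ []       _        dys _    = dys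
  distinct-++ (x ∷ xs) (x∉ ∷ d) dys disj =
    x∉xs++ys ∷ distinct-++ xs d dys (λ p q → disj p (there q))
    where
    x∉xs++ys : x ∉ xs ++ _
    x∉xs++ys p with ∈-++⁻ xs p
    ... | inj₁ q = x∉ q
    ... | inj₂ q = disj q (here refl)

  distinct-backtrack : ∀ a xs → Distinct (a ∷ xs) → Distinct (backtrack a xs)
  distinct-backtrack a []       _        = []
  distinct-backtrack a (x ∷ xs) (a∉ ∷ d) =
    distinct-++ (backtrack x xs) (distinct-backtrack x xs d) ((λ ()) ∷ [])
      (λ { (here refl) q → a∉ (∈-backtrack x xs q) })

  end∉backtrack : Walk R a xs b → Distinct (a ∷ xs) → b ∉ backtrack a xs
  end∉backtrack ε                     _        ()
  end∉backtrack (_◅_ {b = x} {xs} _ w) (a∉ ∷ d) p with ∈-++⁻ (backtrack x xs) p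
  ... | inj₁ q         = end∉backtrack w d q
  ... | inj₂ (here refl) = a∉ (end∈ w)

  record FirstEntry (R : Rel k) (a : Fin k) (xs S : List (Fin k)) : Set where
    field
      {prefix rest} : List (Fin k)
      {entry}       : Fin k
      walk          : Walk R a prefix entry
      entry∈S       : entry ∈ S
      earlier∉S     : ∀ {y} → y ∈ prefix → y ≡ entry ⊎ y ∉ S
      splits        : xs ≡ prefix ++ rest

  firstEntry : ∀ S → Walk R a xs b → b ∈ S → a ∉ S → FirstEntry R a xs S
  firstEntry S ε b∈S a∉S = ⊥-elim (a∉S b∈S)
  firstEntry S (_◅_ {b = x} {xs} r w) b∈S a∉S with any? (x ≟_) S
  ... | yes x∈S = record
    { walk = r ◅ ε ; entry∈S = x∈S ; splits = refl
    ; earlier∉S = λ { (here refl) → inj₁ refl } }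
  ... | no x∉S = record
    { walk = r ◅ walk ; entry∈S = entry∈S ; splits = cong (x ∷_) splits
    ; earlier∉S = λ { (here refl) → inj₂ x∉S ; (there q) → earlier∉S q } }
    where open FirstEntry (firstEntry S w b∈S x∉S)

  lookup-injective : Distinct xs → Injective _≡_ _≡_ (lookup xs)
  lookup-injective {x ∷ xs} _        {zero}  {zero}  _ = refl
  lookup-injective {x ∷ xs} (x∉ ∷ _) {zero}  {suc j} e = ⊥-elim (x∉ (subst (_∈ xs) (sym e) (∈-lookup j)))
  lookup-injective {x ∷ xs} (x∉ ∷ _) {suc i} {zero}  e = ⊥-elim (x∉ (subst (_∈ xs) e (∈-lookup i)))
  lookup-injective {x ∷ xs} (_ ∷ d)  {suc i} {suc j} e = cong suc (lookup-injective d e)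

  lookup-step : Walk R a xs b → (i : Fin (length xs)) →
                R (lookup (a ∷ xs) (inject₁ i)) (lookup (a ∷ xs) (suc i))
  lookup-step (r ◅ w) zero    = r
  lookup-step (r ◅ w) (suc i) = lookup-step w i

  lookup-last : Walk R a xs b → lookup (a ∷ xs) (fromℕ (length xs)) ≡ b
  lookup-last ε       = refl
  lookup-last (_ ◅ w) = lookup-last w

  simpleWalk⇒path : Walk R a xs b → Distinct (a ∷ xs) → Path R a b (length xs)
  simpleWalk⇒path {a = a} {xs} w d = record
    { vert = lookup (a ∷ xs) ; start = refl ; end = lookup-last w
    ; step = lookup-step w ; distinct = lookup-injective d }

  tabulate-walk : ∀ L (g : Fin (suc L) → Fin k) → (∀ i → R (g (inject₁ i)) (g (suc i))) →
                  Walk R (g zero) (tabulate (λ i → g (suc i))) (g (fromℕ L))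
  tabulate-walk zero    g st = ε
  tabulate-walk (suc L) g st = st zero ◅ tabulate-walk L (λ i → g (suc i)) (λ i → st (suc i))

  distinct-tabulate : ∀ n (g : Fin n → Fin k) → Injective _≡_ _≡_ g → Distinct (tabulate g)
  distinct-tabulate zero    g inj = []
  distinct-tabulate (suc n) g inj =
    head∉ ∷ distinct-tabulate n (λ i → g (suc i)) (λ e → suc-injective (inj e))
    where
    head∉ : g zero ∉ tabulate (λ i → g (suc i))
    head∉ p with ∈-tabulate⁻ p
    ... | i , e with inj e
    ... | ()

  path⇒walk : ∀ {L} → Path R a b L → ∃[ xs ] Walk R a xs b × Distinct (a ∷ xs) × length xs ≡ L
  path⇒walk {R = R} {L = L} p =
    tabulate (λ i → vert (suc i)) ,
    subst₂ (λ s t → Walk R s _ t) start end (tabulate-walk L vert step) ,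
    subst (λ s → Distinct (s ∷ _)) start (distinct-tabulate (suc L) vert distinct) ,
    length-tabulate _
    where open Path p

  closeCycle : Walk R a xs b → R b a → Distinct (a ∷ xs) → 2 ≤ length xs → Cycle R
  closeCycle {R = R} {a = a} {xs = x₁ ∷ x₂ ∷ rest} w r d _ = record
    { len = length rest ; vert = lookup (a ∷ x₁ ∷ x₂ ∷ rest) ; step = lookup-step w
    ; close = subst (λ t → R t a) (sym (lookup-last w)) r ; distinct = lookup-injective d }
  closeCycle {xs = _ ∷ []} _ _ _ (s≤s ())

path-zero : ∀ {k} {R : Rel k} {a b} → Path R a b 0 → a ≡ b
path-zero p = trans (sym (Path.start p)) (Path.end p)

module AcyclicGraph {k : ℕ} {S : Rel k} (S-sym : ∀ {x y} → S x y → S y x) (acyclic : ¬ Cycle S) where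

  private
    variable
      u v p q : Fin k
      xs ys : List (Fin k)

    loop-long : ∀ {e ps rest} zs → Walk S u ps e → Walk S q zs e → u ∉ q ∷ ys → e ∈ q ∷ ys →
                p ∷ xs ≡ ps ++ rest → p ≢ q → 2 ≤ length (ps ++ backtrack q zs)
    loop-long zs       ε             _ u∉Q e∈Q _    _   = ⊥-elim (u∉Q e∈Q)
    loop-long []       (_ ◅ ε)       ε _   _   refl p≢q = ⊥-elim (p≢q refl)
    loop-long (z ∷ zs) (_ ◅ ε)       _ _   _   _    _   =
      s≤s (subst (1 ≤_) (sym (length-++ (backtrack z zs))) (m≤n+m 1 _))
    loop-long zs       (_ ◅ _ ◅ _)   _ _   _   _    _   = s≤s (s≤s z≤n)

  -- Follow the first branch until it meets the second one, then return along the second.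
  branches-meet⇒cycle : S u p → Walk S p xs v → S u q → Walk S q ys v →
                        Distinct (u ∷ p ∷ xs) → Distinct (u ∷ q ∷ ys) → p ≢ q → ⊥
  branches-meet⇒cycle {u} {p} {xs = xs} {q = q} {ys} r w r′ w′ dP (u∉Q ∷ dQ) p≢q =
    close (prefixTo w′ entry∈S)
    where
    open FirstEntry (firstEntry (q ∷ ys) (r ◅ w) (end∈ w′) u∉Q)

    close : ∃[ zs ] Walk S q zs entry × ∃[ rest′ ] ys ≡ zs ++ rest′ → ⊥
    close (zs , back , _ , ys≡) =
      acyclic (closeCycle (walk ◅◅ mapWalk S-sym (reverseWalk back)) (S-sym r′) loop-distinct
                          (loop-long zs walk back u∉Q entry∈S splits p≢q))
      where
      back-distinct : Distinct (q ∷ zs)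
      back-distinct = distinct-++ˡ (q ∷ zs) (subst (λ t → Distinct (q ∷ t)) ys≡ dQ)

      back⊆Q : ∀ {y} → y ∈ q ∷ zs → y ∈ q ∷ ys
      back⊆Q (here e)  = here e
      back⊆Q (there i) = there (subst (_ ∈_) (sym ys≡) (∈-++⁺ˡ i))

      disjoint : ∀ {y} → y ∈ backtrack q zs → y ∉ u ∷ prefix
      disjoint i (here refl) = u∉Q (back⊆Q (∈-backtrack q zs i))
      disjoint i (there j) with earlier∉S j
      ... | inj₁ refl = end∉backtrack back back-distinct i
      ... | inj₂ y∉Q  = y∉Q (back⊆Q (∈-backtrack q zs i))

      loop-distinct : Distinct (u ∷ prefix ++ backtrack q zs)
      loop-distinct =
        distinct-++ (u ∷ prefix) (distinct-++ˡ (u ∷ prefix) (subst (λ t → Distinct (u ∷ t)) splits dP))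
                    (distinct-backtrack q zs back-distinct) disjoint

  simpleWalk-unique : Walk S u xs v → Walk S u ys v → Distinct (u ∷ xs) → Distinct (u ∷ ys) → xs ≡ ys
  simpleWalk-unique ε       ε       _        _         = refl
  simpleWalk-unique ε       (_ ◅ w) _        (u∉ ∷ _)  = ⊥-elim (u∉ (end∈ w))
  simpleWalk-unique (_ ◅ w) ε       (u∉ ∷ _) _         = ⊥-elim (u∉ (end∈ w))
  simpleWalk-unique (_◅_ {b = p} r w) (_◅_ {b = q} r′ w′) dP dQ with p ≟ q | dP | dQ
  ... | yes refl | _ ∷ d | _ ∷ d′ = cong (p ∷_) (simpleWalk-unique w w′ d d′)
  ... | no p≢q   | _     | _      = ⊥-elim (branches-meet⇒cycle r w r′ w′ dP dQ p≢q)

++-prefix-comparable : ∀ {ℓ} {X : Set ℓ} (xs ys zs ws : List X) → xs ++ ys ≡ zs ++ ws →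
                       ∃[ mid ] (zs ≡ xs ++ mid ⊎ xs ≡ zs ++ mid)
++-prefix-comparable []       _  zs       _  _ = zs , inj₁ refl
++-prefix-comparable (x ∷ xs) _  []       _  _ = x ∷ xs , inj₂ refl
++-prefix-comparable (x ∷ xs) ys (z ∷ zs) ws e with ∷-injective e
... | refl , e′ with ++-prefix-comparable xs ys zs ws e′
...   | mid , inj₁ refl = mid , inj₁ refl
...   | mid , inj₂ refl = mid , inj₂ refl

module OrientedTree {k : ℕ} {A : Rel k} (oriented : IsOriented A) (acyclic : ¬ Cycle (Underlying A)) where

  open AcyclicGraph {S = Underlying A} swap acyclic

  private
    variable
      a b c x y : Fin k
      xs ys : List (Fin k)
      L L′ : ℕ

  ¬closedWalk : A a x → Walk A x xs a → Distinct (x ∷ xs) → ⊥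
  ¬closedWalk r ε            _ = proj₁ oriented _ r
  ¬closedWalk r (r′ ◅ ε)     _ = proj₂ oriented _ _ r r′
  ¬closedWalk r w@(_ ◅ _ ◅ _) d = acyclic (closeCycle (mapWalk inj₁ w) (inj₁ r) d (s≤s (s≤s z≤n)))

  walk-distinct : Walk A a xs b → Distinct (a ∷ xs)
  walk-distinct ε                      = (λ ()) ∷ []
  walk-distinct (_◅_ {a = a} {b = x} r w) = a∉ ∷ walk-distinct w
    where
    a∉ : a ∉ x ∷ _
    a∉ a∈ with prefixTo w a∈
    ... | ys , back , _ , refl = ¬closedWalk r back (distinct-++ˡ (x ∷ ys) (walk-distinct w))

  walk-unique : Walk A a xs b → Walk A a ys b → xs ≡ ys
  walk-unique w w′ = simpleWalk-unique (mapWalk inj₁ w) (mapWalk inj₁ w′) (walk-distinct w) (walk-distinct w′)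

  walk⇒path : Walk A a xs b → Path A a b (length xs)
  walk⇒path w = simpleWalk⇒path w (walk-distinct w)

  path-length-unique : Path A a b L → Path A a b L′ → L ≡ L′
  path-length-unique p p′ with path⇒walk p | path⇒walk p′
  ... | _ , w , _ , refl | _ , w′ , _ , refl = cong length (walk-unique w w′)

  _⁀_ : Path A a b L → Path A b c L′ → Path A a c (L + L′)
  p ⁀ p′ with path⇒walk p | path⇒walk p′
  ... | xs , w , _ , refl | _ , w′ , _ , refl = subst (Path A _ _) (length-++ xs) (walk⇒path (w ◅◅ w′))

  path-antisym : Path A a b L → Path A b a L′ → a ≡ b
  path-antisym p p′ with path⇒walk p | path⇒walk p′
  ... | [] , ε , _ | _ = refl
  ... | _ ∷ _ , r ◅ w , _ | _ , w′ , _ = ⊥-elim (¬closedWalk r (w ◅◅ w′) (walk-distinct (w ◅◅ w′)))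

  between-comparable : ∀ {p q L₁ L₂ L₃ L₄} → Path A p x L₁ → Path A x q L₂ → Path A p y L₃ → Path A y q L₄ →
                       Reach A x y ⊎ Reach A y x
  between-comparable p₁ p₂ p₃ p₄ with path⇒walk p₁ | path⇒walk p₂ | path⇒walk p₃ | path⇒walk p₄
  ... | xs , w₁ , _ | ys , w₂ , _ | zs , w₃ , _ | ws , w₄ , _
    with ++-prefix-comparable xs ys zs ws (walk-unique (w₁ ◅◅ w₂) (w₃ ◅◅ w₄))
  ... | mid , inj₁ refl with splitWalk xs w₃
  ...   | _ , w₅ , w₆ with end-unique w₁ w₅
  ...     | refl = inj₁ (_ , walk⇒path w₆)
  between-comparable _ _ _ _ | xs , w₁ , _ | _ | zs , w₃ , _ | _ | mid , inj₂ refl with splitWalk zs w₁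
  ...   | _ , w₅ , w₆ with end-unique w₃ w₅
  ...     | refl = inj₂ (_ , walk⇒path w₆)

≢-≢⇒≡ : ∀ {a b c : Bool} → a ≢ c → b ≢ c → a ≡ b
≢-≢⇒≡ a≢c b≢c = trans (¬-not a≢c) (sym (¬-not b≢c))

record P₇Walk {V : Set} (Adj : V → V → Set) (v : ℕ → V) : Set where
  field
    adjacent : ∀ i → Adj (v i) (v (suc i))
    far      : ∀ i j → 2 ≤ j → j ≤ 5 → ¬ Adj (v i) (v (j + i))
    distinct : ∀ i j → 1 ≤ j → j ≤ 6 → v i ≢ v (j + i)

  far′ : ∀ i j {_ : True (2 ≤? j)} {_ : True (j ≤? 5)} → ¬ Adj (v i) (v (j + i))
  far′ i j {p} {q} = far i j (toWitness p) (toWitness q)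

  distinct′ : ∀ i j {_ : True (1 ≤? j)} {_ : True (j ≤? 6)} → v i ≢ v (j + i)
  distinct′ i j {p} {q} = distinct i j (toWitness p) (toWitness q)

module SideChange {V : Set} {Adj E : V → V → Set} (E-sym : Symmetric E) (E-trans : Transitive E)
  (side : V → Bool)
  (adjacent⇒≉ : ∀ {x y} → x ≢ y → Adj x y → ¬ E x y)
  (opposite⇒≈ : ∀ {x y} → x ≢ y → side x ≢ side y → ¬ Adj x y → E x y)
  {v : ℕ → V} (walk : P₇Walk Adj v) where

  open P₇Walk walk

  private
    ≉-next : ∀ i → ¬ E (v i) (v (suc i))
    ≉-next i = adjacent⇒≉ (distinct′ i 1) (adjacent i)

  private module Classes (s₀≢s₁ : side (v 0) ≢ side (v 1)) where

    OppositeClass : V → Set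
    OppositeClass w = (side w ≡ side (v 0) × E w (v 1)) ⊎ (side w ≡ side (v 1) × E w (v 0))

    classify : ∀ {w} → v 0 ≢ w → v 1 ≢ w → ¬ Adj (v 0) w → ¬ Adj (v 1) w → OppositeClass w
    classify {w} 0≢w 1≢w ¬adj₀ ¬adj₁ with side w ≟ᵇ side (v 0)
    ... | yes s≡s₀ = inj₁ (s≡s₀ , E-sym (opposite⇒≈ 1≢w (λ e → s₀≢s₁ (trans (sym s≡s₀) (sym e))) ¬adj₁))
    ... | no  s≢s₀ = inj₂ (≢-≢⇒≡ s≢s₀ (λ e → s₀≢s₁ (sym e)) ,
                          E-sym (opposite⇒≈ 0≢w (λ e → s≢s₀ (sym e)) ¬adj₀))

    ≉₀₁ : ¬ E (v 0) (v 1)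
    ≉₀₁ = ≉-next 0

    alternating : OppositeClass (v 3) → OppositeClass (v 4) → OppositeClass (v 5) → ⊥
    alternating (inj₁ (_ , e₃)) (inj₁ (_ , e₄)) _ = ≉-next 3 (E-trans e₃ (E-sym e₄))
    alternating (inj₂ (_ , e₃)) (inj₂ (_ , e₄)) _ = ≉-next 3 (E-trans e₃ (E-sym e₄))
    alternating _ (inj₁ (_ , e₄)) (inj₁ (_ , e₅)) = ≉-next 4 (E-trans e₄ (E-sym e₅))
    alternating _ (inj₂ (_ , e₄)) (inj₂ (_ , e₅)) = ≉-next 4 (E-trans e₄ (E-sym e₅))
    alternating (inj₂ (_ , e₃)) (inj₁ (s₄ , e₄)) (inj₂ (s₅ , e₅)) with side (v 2) ≟ᵇ side (v 1)
    ... | yes s₂ = ≉₀₁ (E-trans e₀₂ (E-trans e₂₄ e₄))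
      where
      e₀₂ : E (v 0) (v 2)
      e₀₂ = opposite⇒≈ (distinct′ 0 2) (λ e → s₀≢s₁ (trans e s₂)) (far′ 0 2)
      e₂₄ : E (v 2) (v 4)
      e₂₄ = opposite⇒≈ (distinct′ 2 2) (λ e → s₀≢s₁ (trans (sym s₄) (trans (sym e) s₂))) (far′ 2 2)
    ... | no s₂≢s₁ = ≉-next 2 (E-trans e₂₅ (E-trans e₅ (E-sym e₃)))
      where
      s₂ : side (v 2) ≡ side (v 0)
      s₂ = ≢-≢⇒≡ s₂≢s₁ s₀≢s₁
      e₂₅ : E (v 2) (v 5)
      e₂₅ = opposite⇒≈ (distinct′ 2 3) (λ e → s₀≢s₁ (trans (sym s₂) (trans e s₅))) (far′ 2 3)
    alternating (inj₁ (s₃ , e₃)) (inj₂ (s₄ , e₄)) (inj₁ (s₅ , e₅)) with side (v 6) ≟ᵇ side (v 1)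
    ... | yes s₆ = ≉-next 5 (E-trans (E-trans e₅ (E-sym e₃)) e₃₆)
      where
      e₃₆ : E (v 3) (v 6)
      e₃₆ = opposite⇒≈ (distinct′ 3 3) (λ e → s₀≢s₁ (trans (sym s₃) (trans e s₆))) (far′ 3 3)
    ... | no s₆≢s₁ = ≉₀₁ (E-trans (E-sym e₄) (E-trans e₄₆ (E-sym e₁₆)))
      where
      s₆ : side (v 6) ≡ side (v 0)
      s₆ = ≢-≢⇒≡ s₆≢s₁ s₀≢s₁
      e₄₆ : E (v 4) (v 6)
      e₄₆ = opposite⇒≈ (distinct′ 4 2) (λ e → s₀≢s₁ (trans (sym s₆) (trans (sym e) s₄))) (far′ 4 2)
      e₁₆ : E (v 1) (v 6)
      e₁₆ = opposite⇒≈ (distinct′ 1 5) (λ e → s₀≢s₁ (trans (sym s₆) (sym e))) (far′ 1 5)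

  ¬side-change : ¬ side (v 0) ≢ side (v 1)
  ¬side-change s₀≢s₁ = alternating (classify (distinct′ 0 3) (distinct′ 1 2) (far′ 0 3) (far′ 1 2))
                                   (classify (distinct′ 0 4) (distinct′ 1 3) (far′ 0 4) (far′ 1 3))
                                   (classify (distinct′ 0 5) (distinct′ 1 4) (far′ 0 5) (far′ 1 4))
    where open Classes s₀≢s₁

module TreeOrder {V : Set} {Adj E R : V → V → Set} (E-sym : Symmetric E) (E-trans : Transitive E)
  (R-trans : Transitive R) (depth : V → ℕ) (R⇒depth< : ∀ {x y} → x ≢ y → R x y → depth x < depth y)
  (R-predecessors-comparable : ∀ {x y z} → R y x → R z x → R y z ⊎ R z y)
  (adjacent⇔ : ∀ {x y} → x ≢ y → Adj x y ⇔ ((R x y ⊎ R y x) × ¬ E x y))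
  {v : ℕ → V} (walk : P₇Walk Adj v) where

  open P₇Walk walk

  private
    comparable : ∀ i → R (v i) (v (suc i)) ⊎ R (v (suc i)) (v i)
    comparable i = proj₁ (Equivalence.to (adjacent⇔ (distinct′ i 1)) (adjacent i))

    ≉-next : ∀ i → ¬ E (v i) (v (suc i))
    ≉-next i = proj₂ (Equivalence.to (adjacent⇔ (distinct′ i 1)) (adjacent i))

    comparable⇒adjacent : ∀ {x y} → x ≢ y → R x y ⊎ R y x → ¬ E x y → Adj x y
    comparable⇒adjacent x≢y c ≉ = Equivalence.from (adjacent⇔ x≢y) (c , ≉)

  ¬local-max : depth (v 1) ≤ depth (v 2) → depth (v 3) ≤ depth (v 2) → ⊥
  ¬local-max d₁≤d₂ d₃≤d₂ = ¬¬e₁₃ λ e₁₃ → branch e₁₃ (R-predecessors-comparable r₁₂ r₃₂)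
    where
    r₁₂ : R (v 1) (v 2)
    r₁₂ with comparable 1
    ... | inj₁ r = r
    ... | inj₂ r = ⊥-elim (<⇒≱ (R⇒depth< (λ e → distinct′ 1 1 (sym e)) r) d₁≤d₂)

    r₃₂ : R (v 3) (v 2)
    r₃₂ with comparable 2
    ... | inj₁ r = ⊥-elim (<⇒≱ (R⇒depth< (distinct′ 2 1) r) d₃≤d₂)
    ... | inj₂ r = r

    ¬¬e₁₃ : ¬ ¬ E (v 1) (v 3)
    ¬¬e₁₃ ¬e = far′ 1 2 (comparable⇒adjacent (distinct′ 1 2) (R-predecessors-comparable r₁₂ r₃₂) ¬e)

    branch : E (v 1) (v 3) → R (v 1) (v 3) ⊎ R (v 3) (v 1) → ⊥
    branch e₁₃ (inj₂ r₃₁) =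
      far′ 0 3 (comparable⇒adjacent (distinct′ 0 3) comparable₀₃ (λ e₀₃ → ≉-next 0 (E-trans e₀₃ (E-sym e₁₃))))
      where
      comparable₀₃ : R (v 0) (v 3) ⊎ R (v 3) (v 0)
      comparable₀₃ with comparable 0
      ... | inj₁ r₀₁ = R-predecessors-comparable r₀₁ r₃₁
      ... | inj₂ r₁₀ = inj₂ (R-trans r₃₁ r₁₀)
    branch e₁₃ (inj₁ r₁₃) =
      far′ 1 3 (comparable⇒adjacent (distinct′ 1 3) comparable₁₄ (λ e₁₄ → ≉-next 3 (E-trans (E-sym e₁₃) e₁₄)))
      where
      comparable₁₄ : R (v 1) (v 4) ⊎ R (v 4) (v 1)
      comparable₁₄ with comparable 3
      ... | inj₁ r₃₄ = inj₁ (R-trans r₁₃ r₃₄)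
      ... | inj₂ r₄₃ = R-predecessors-comparable r₁₃ r₄₃

consecutive-change : ∀ (s : ℕ → Bool) q → s q ≢ s 0 → ∃[ p ] s p ≢ s (suc p)
consecutive-change s zero    s≢ = ⊥-elim (s≢ refl)
consecutive-change s (suc q) s≢ with s q ≟ᵇ s 0
... | yes e  = q , λ e′ → s≢ (trans (sym e′) e)
... | no s≢′ = consecutive-change s q s≢′

argmax-Fin : ∀ {n} (d : Fin n → ℕ) → Fin n → ∃[ x ] ∀ y → d y ≤ d x
argmax-Fin {n} d x₀ = argmax d x₀ (allFin n) , λ y → All.lookup (f[xs]≤f[argmax] {f = d} x₀ (allFin n)) (∈-allFin y)

%-injective-window : ∀ {a b n} .{{_ : NonZero n}} → a ≤ b → b < a + n → a % n ≡ b % n → a ≡ b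
%-injective-window {a} {b} {n} a≤b b<a+n a%n≡b%n = begin
  a                    ≡⟨ m≡m%n+[m/n]*n a n ⟩
  a % n + a / n * n    ≡⟨ cong (λ q → a % n + q * n) (≤-antisym (/-monoˡ-≤ n a≤b) b/n≤a/n) ⟩
  a % n + b / n * n    ≡⟨ cong (_+ b / n * n) a%n≡b%n ⟩
  b % n + b / n * n    ≡⟨ m≡m%n+[m/n]*n b n ⟨
  b                    ∎
  where
  open ≡-Reasoning
  r : ℕ
  r = a % n
  a+n≡ : a + n ≡ r + suc (a / n) * n
  a+n≡ = begin
    a + n                  ≡⟨ cong (_+ n) (m≡m%n+[m/n]*n a n) ⟩
    r + a / n * n + n      ≡⟨ +-assoc r _ n ⟩
    r + (a / n * n + n)    ≡⟨ cong (λ t → r + t) (+-comm _ n) ⟩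
    r + suc (a / n) * n    ∎
  b≡ : b ≡ r + b / n * n
  b≡ = trans (m≡m%n+[m/n]*n b n) (cong (_+ b / n * n) (sym a%n≡b%n))
  b/n≤a/n : b / n ≤ a / n
  b/n≤a/n = m<1+n⇒m≤n (*-cancelʳ-< n (b / n) (suc (a / n))
              (+-cancelˡ-< r _ _ (subst₂ _<_ b≡ a+n≡ b<a+n)))

succMod⇔ : ∀ {n} .{{_ : NonZero n}} {a b : Fin n} → SuccMod n a b ⇔ toℕ b ≡ suc (toℕ a) % n
succMod⇔ {n} {a} {b} = mk⇔ to from
  where
  to : SuccMod n a b → toℕ b ≡ suc (toℕ a) % n
  to (inj₁ b≡1+a)         = trans b≡1+a (sym (m<n⇒m%n≡m (subst (_< n) b≡1+a (toℕ<n b))))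
  to (inj₂ (1+a≡n , b≡0)) = trans b≡0 (sym (trans (cong (_% n) 1+a≡n) (n%n≡0 n)))
  from : toℕ b ≡ suc (toℕ a) % n → SuccMod n a b
  from b≡ with m≤n⇒m<n∨m≡n (toℕ<n a)
  ... | inj₁ 1+a<n = inj₁ (trans b≡ (m<n⇒m%n≡m 1+a<n))
  ... | inj₂ 1+a≡n = inj₂ (1+a≡n , trans b≡ (trans (cong (_% n) 1+a≡n) (n%n≡0 n)))

module Rim (n : ℕ) .{{_ : NonZero n}} where

  rim : ℕ → Fin n
  rim i = i mod n

  toℕ-rim : ∀ i → toℕ (rim i) ≡ i % n
  toℕ-rim i = toℕ-fromℕ< (m%n<n i n)

  rim-toℕ : ∀ x → rim (toℕ x) ≡ x
  rim-toℕ x = toℕ-injective (trans (toℕ-rim (toℕ x)) (m<n⇒m%n≡m (toℕ<n x)))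

  rim-periodic : ∀ i → rim (i + n) ≡ rim i
  rim-periodic i = toℕ-injective (trans (toℕ-rim (i + n)) (trans ([m+n]%n≡m%n i n) (sym (toℕ-rim i))))

  private
    suc-% : ∀ i → suc (i % n) % n ≡ suc i % n
    suc-% i = begin
      suc (i % n) % n                ≡⟨ [m+kn]%n≡m%n (suc (i % n)) (i / n) n ⟨
      (suc (i % n) + i / n * n) % n  ≡⟨ cong (λ t → suc t % n) (m≡m%n+[m/n]*n i n) ⟨
      suc i % n                      ∎
      where open ≡-Reasoning

    rim-≡⇒%-≡ : ∀ {i j} → rim i ≡ rim j → i % n ≡ j % n
    rim-≡⇒%-≡ {i} {j} e = trans (sym (toℕ-rim i)) (trans (cong toℕ e) (toℕ-rim j))

    j+i<i+n : ∀ {i j} → j < n → j + i < i + n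
    j+i<i+n {i} {j} j<n = subst (j + i <_) (+-comm n i) (+-monoˡ-< i j<n)

  rim-succMod⇔ : ∀ {i j} → SuccMod n (rim i) (rim j) ⇔ j % n ≡ suc i % n
  rim-succMod⇔ {i} {j} =
    subst₂ (λ x y → SuccMod n (rim i) (rim j) ⇔ x ≡ y)
           (toℕ-rim j) (trans (cong (λ t → suc t % n) (toℕ-rim i)) (suc-% i)) succMod⇔

  rim-adjacent : ∀ i → CycleAdj n (rim i) (rim (suc i))
  rim-adjacent i = inj₁ (Equivalence.from rim-succMod⇔ refl)

  rim-distinct : ∀ i {j} → 0 < j → j < n → rim i ≢ rim (j + i)
  rim-distinct i {j} 0<j j<n e = <-irrefl i≡j+i (m<n+m i 0<j)
    where
    i≡j+i : i ≡ j + i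
    i≡j+i = %-injective-window (m≤n+m i j) (j+i<i+n j<n) (rim-≡⇒%-≡ e)

  rim-far : ∀ i {j} → 2 ≤ j → j + 2 ≤ n → ¬ CycleAdj n (rim i) (rim (j + i))
  rim-far i {j} 2≤j j+2≤n = far
    where
    1+j<n : suc j < n
    1+j<n = subst (_≤ n) (+-comm j 2) j+2≤n

    far : ¬ CycleAdj n (rim i) (rim (j + i))
    far (inj₁ s) = <-irrefl (+-cancelʳ-≡ i 1 j 1+i≡j+i) 2≤j
      where
      1+i≡j+i : suc i ≡ j + i
      1+i≡j+i = %-injective-window (+-monoˡ-≤ i (<⇒≤ 2≤j))
                  (<-trans (j+i<i+n (<-trans (n<1+n j) 1+j<n)) (n<1+n _))
                  (sym (Equivalence.to rim-succMod⇔ s))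
    far (inj₂ s) = <-irrefl (+-cancelʳ-≡ i (suc j) n (trans 1+j+i≡i+n (+-comm i n))) 1+j<n
      where
      1+j+i≡i+n : suc (j + i) ≡ i + n
      1+j+i≡i+n = %-injective-window (subst (suc (j + i) ≤_) (+-comm n i) (+-monoˡ-≤ i (<⇒≤ 1+j<n)))
                    (+-monoˡ-< n (s≤s (m≤n+m i j)))
                    (trans (sym (Equivalence.to rim-succMod⇔ s)) (sym ([m+n]%n≡m%n i n)))

  rim-P₇Walk : n ≥ 7 → ∀ p → P₇Walk (CycleAdj n) (λ j → rim (j + p))
  rim-P₇Walk n≥7 p = record
    { adjacent = λ i → rim-adjacent (i + p)
    ; far      = λ i j 2≤j j≤5 → subst (λ t → ¬ CycleAdj n (rim (i + p)) (rim t)) (sym (+-assoc j i p))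
                                       (rim-far (i + p) 2≤j (≤-trans (+-monoˡ-≤ 2 j≤5) n≥7))
    ; distinct = λ i j 1≤j j≤6 → subst (λ t → rim (i + p) ≢ rim t) (sym (+-assoc j i p))
                                       (rim-distinct (i + p) 1≤j (≤-trans (s≤s j≤6) n≥7))
    }

  rim-hits : ∀ j → j ≤ n → ∀ x → ∃[ p ] rim (j + p) ≡ x
  rim-hits j j≤n x = toℕ x + n ∸ j , (begin
    rim (j + (toℕ x + n ∸ j))  ≡⟨ cong rim (m+[n∸m]≡n (≤-trans j≤n (m≤n+m n (toℕ x)))) ⟩
    rim (toℕ x + n)            ≡⟨ rim-periodic (toℕ x) ⟩
    rim (toℕ x)                ≡⟨ rim-toℕ x ⟩
    x                          ∎)
    where open ≡-Reasoning

  constant-or-change : (s : Fin n → Bool) → (∀ i → s i ≡ s (rim 0)) ⊎ ∃[ p ] s (rim p) ≢ s (rim (suc p))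
  constant-or-change s with all? (λ i → s i ≟ᵇ s (rim 0))
  ... | yes constant = inj₁ constant
  ... | no ¬constant with ¬∀⟶∃¬ n _ (λ i → s i ≟ᵇ s (rim 0)) ¬constant
  ...   | i , sᵢ≢s₀ =
    inj₂ (consecutive-change (s ∘ rim) (toℕ i) (subst (λ t → s t ≢ s (rim 0)) (sym (rim-toℕ i)) sᵢ≢s₀))

neg-minus : ∀ (x y : ℤ) → - (x - y) ≡ y - x
neg-minus = solve-∀

minus-trans : ∀ (x y z : ℤ) → (x - y) ℤ.+ (y - z) ≡ x - z
minus-trans = solve-∀

plus-minus : ∀ (x y : ℤ) → (x ℤ.+ y) - x ≡ y
plus-minus = solve-∀

neg-cancel : ∀ (x y : ℤ) → - y ≡ - (x ℤ.+ y) ℤ.+ x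
neg-cancel = solve-∀

neg-plus-cancel : ∀ (x y : ℤ) → y ≡ - x ℤ.+ (x ℤ.+ y)
neg-plus-cancel = solve-∀

module WheelWillow {n m k : ℕ} {A : Rel k} (oriented : IsOriented A) (acyclic : ¬ Cycle (Underlying A))
  (f : Fin (suc n) → Fin k) (f-injective : Injective _≡_ _≡_ f)
  (represents : ∀ u v → u ≢ v →
     WheelAdj n u v ⇔ (∃ λ L → (Path A (f u) (f v) L ⊎ Path A (f v) (f u) L) × ¬ (m ∣ L)))
  where

  open OrientedTree oriented acyclic
  open ≡-Reasoning

  Linked : Fin k → Fin k → ℕ → Set
  Linked a b L = Path A a b L ⊎ Path A b a L

  centre : Fin k
  centre = f zero

  V : Fin n → Fin k
  V i = f (suc i)

  V≢centre : ∀ {i} → V i ≢ centre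
  V≢centre e with f-injective e
  ... | ()

  isDescendant : ∀ {a L} → Linked centre a L → Bool
  isDescendant (inj₁ _) = true
  isDescendant (inj₂ _) = false

  signedDepth : ∀ {a L} → Linked centre a L → ℤ
  signedDepth {L = L} (inj₁ _) = + L
  signedDepth {L = L} (inj₂ _) = - + L

  signedDepth-step : ∀ {a b La Lb L} (sa : Linked centre a La) (sb : Linked centre b Lb) → b ≢ centre →
                     Path A a b L → signedDepth sb ≡ signedDepth sa ℤ.+ + L
  signedDepth-step {La = La} {Lb} {L} (inj₁ pa) (inj₁ pb) _ p = begin
    + Lb          ≡⟨ cong +_ (path-length-unique (pa ⁀ p) pb) ⟨
    + (La ℕ.+ L)  ≡⟨ pos-+ La L ⟩
    + La ℤ.+ + L  ∎
  signedDepth-step {La = La} {Lb} {L} (inj₂ pa) (inj₂ pb) _ p = begin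
    - + Lb                     ≡⟨ neg-cancel (+ L) (+ Lb) ⟩
    - (+ L ℤ.+ + Lb) ℤ.+ + L   ≡⟨ cong (λ t → - t ℤ.+ + L) (pos-+ L Lb) ⟨
    - + (L ℕ.+ Lb) ℤ.+ + L     ≡⟨ cong (λ t → - + t ℤ.+ + L) (path-length-unique (p ⁀ pb) pa) ⟩
    - + La ℤ.+ + L             ∎
  signedDepth-step {La = La} {Lb} {L} (inj₂ pa) (inj₁ pb) _ p = begin
    + Lb                       ≡⟨ neg-plus-cancel (+ La) (+ Lb) ⟩
    - + La ℤ.+ (+ La ℤ.+ + Lb) ≡⟨ cong (λ t → - + La ℤ.+ t) (pos-+ La Lb) ⟨
    - + La ℤ.+ + (La ℕ.+ Lb)   ≡⟨ cong (λ t → - + La ℤ.+ + t) (path-length-unique (pa ⁀ pb) p) ⟩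
    - + La ℤ.+ + L             ∎
  signedDepth-step (inj₁ pa) (inj₂ pb) b≢c p = ⊥-elim (b≢c (sym (path-antisym (pa ⁀ p) pb)))

  opposite⇒linked : ∀ {a b La Lb} (sa : Linked centre a La) (sb : Linked centre b Lb) →
                    isDescendant sa ≢ isDescendant sb → ∃[ L ] Linked a b L
  opposite⇒linked (inj₁ pa) (inj₁ pb) ne = ⊥-elim (ne refl)
  opposite⇒linked (inj₁ pa) (inj₂ pb) _  = _ , inj₂ (pb ⁀ pa)
  opposite⇒linked (inj₂ pa) (inj₁ pb) _  = _ , inj₁ (pa ⁀ pb)
  opposite⇒linked (inj₂ pa) (inj₂ pb) ne = ⊥-elim (ne refl)

  spoke : ∀ i → ∃[ L ] Linked centre (V i) L × ¬ (m ∣ L)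
  spoke i = Equivalence.to (represents zero (suc i) (λ ())) tt

  depth : Fin n → ℕ
  depth i = proj₁ (spoke i)

  spokePath : ∀ i → Linked centre (V i) (depth i)
  spokePath i = proj₁ (proj₂ (spoke i))

  descends : Fin n → Bool
  descends i = isDescendant (spokePath i)

  height : Fin n → ℤ
  height i = signedDepth (spokePath i)

  _≈_ : Fin n → Fin n → Set
  i ≈ j = + m ℤ.∣ (height j - height i)

  ≈-sym : ∀ {i j} → i ≈ j → j ≈ i
  ≈-sym {i} {j} e = subst (+ m ℤ.∣_) (neg-minus (height j) (height i)) (ℤ.∣m⇒∣-m e)

  ≈-trans : ∀ {i j l} → i ≈ j → j ≈ l → i ≈ l
  ≈-trans {i} {j} {l} e e′ = subst (+ m ℤ.∣_) (minus-trans (height l) (height j) (height i)) (ℤ.∣m∣n⇒∣m+n e′ e)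

  path⇒≈⇔∣ : ∀ {i j L} → Path A (V i) (V j) L → i ≈ j ⇔ m ∣ L
  path⇒≈⇔∣ {i} {j} p = subst (λ t → (+ m ℤ.∣ t) ⇔ _) (sym height-difference) (mk⇔ ℤ.∣⇒∣ᵤ ℤ.∣ᵤ⇒∣)
    where
    height-difference : height j - height i ≡ + _
    height-difference = trans (cong (_- height i) (signedDepth-step (spokePath i) (spokePath j) V≢centre p))
                              (plus-minus (height i) _)

  linked⇒≈⇔∣ : ∀ {i j L} → Linked (V i) (V j) L → i ≈ j ⇔ m ∣ L
  linked⇒≈⇔∣ (inj₁ p) = path⇒≈⇔∣ p
  linked⇒≈⇔∣ (inj₂ p) = mk⇔ (Equivalence.to (path⇒≈⇔∣ p) ∘ ≈-sym) (≈-sym ∘ Equivalence.from (path⇒≈⇔∣ p))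

  adjacent⇔linked×≉ : ∀ {i j} → i ≢ j → CycleAdj n i j ⇔ ((∃[ L ] Linked (V i) (V j) L) × ¬ i ≈ j)
  adjacent⇔linked×≉ {i} {j} i≢j = mk⇔
    (λ a → let L , l , ∤L = Equivalence.to adjacent a in (L , l) , ∤L ∘ Equivalence.to (linked⇒≈⇔∣ l))
    (λ { ((L , l) , ≉) → Equivalence.from adjacent (L , l , ≉ ∘ Equivalence.from (linked⇒≈⇔∣ l)) })
    where
    adjacent : CycleAdj n i j ⇔ (∃[ L ] Linked (V i) (V j) L × ¬ (m ∣ L))
    adjacent = represents (suc i) (suc j) (i≢j ∘ suc-injective)

  adjacent⇒≉ : ∀ {i j} → i ≢ j → CycleAdj n i j → ¬ i ≈ j
  adjacent⇒≉ i≢j = proj₂ ∘ Equivalence.to (adjacent⇔linked×≉ i≢j)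

  opposite⇒≈ : ∀ {i j} → i ≢ j → descends i ≢ descends j → ¬ CycleAdj n i j → i ≈ j
  opposite⇒≈ {i} {j} i≢j sides ¬adj with opposite⇒linked (spokePath i) (spokePath j) sides
  ... | L , l with m ∣? L
  ...   | yes m∣L = Equivalence.from (linked⇒≈⇔∣ l) m∣L
  ...   | no  m∤L =
    ⊥-elim (¬adj (Equivalence.from (adjacent⇔linked×≉ i≢j) ((L , l) , m∤L ∘ Equivalence.to (linked⇒≈⇔∣ l))))

  -- Paths of A (s = true) or of A with all arcs reversed (s = false): rim vertices all above the
  -- centre are handled as rim vertices all below it in the reversed tree.
  Dir : Bool → Fin k → Fin k → ℕ → Set
  Dir true  a b L = Path A a b L
  Dir false a b L = Path A b a L

  DirReach : Bool → Fin k → Fin k → Set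
  DirReach s a b = ∃[ L ] Dir s a b L

  dir-trans : ∀ s {a b c} → DirReach s a b → DirReach s b c → DirReach s a c
  dir-trans true  (_ , p) (_ , q) = _ , p ⁀ q
  dir-trans false (_ , p) (_ , q) = _ , q ⁀ p

  dir-length : ∀ s {a x y L₁ L₂ L₃} → Dir s a x L₁ → Dir s x y L₂ → Dir s a y L₃ → L₁ ℕ.+ L₂ ≡ L₃
  dir-length true  p q r = path-length-unique (p ⁀ q) r
  dir-length false {L₁ = L₁} {L₂} p q r = trans (+-comm L₁ L₂) (path-length-unique (q ⁀ p) r)

  dir-predecessors-comparable : ∀ s {a x y z Ly Lz} → DirReach s y x → DirReach s z x → Dir s a y Ly → Dir s a z Lz →
             DirReach s y z ⊎ DirReach s z y
  dir-predecessors-comparable true  (_ , p) (_ , q) py pz = between-comparable py p pz q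
  dir-predecessors-comparable false (_ , p) (_ , q) py pz = swap (between-comparable p py q pz)

  linked⇔dir : ∀ s {a b} → (∃[ L ] Linked a b L) ⇔ (DirReach s a b ⊎ DirReach s b a)
  linked⇔dir true  = mk⇔ (λ { (L , inj₁ p) → inj₁ (L , p) ; (L , inj₂ p) → inj₂ (L , p) })
                         (λ { (inj₁ (L , p)) → L , inj₁ p ; (inj₂ (L , p)) → L , inj₂ p })
  linked⇔dir false = mk⇔ (λ { (L , inj₁ p) → inj₂ (L , p) ; (L , inj₂ p) → inj₁ (L , p) })
                         (λ { (inj₁ (L , p)) → L , inj₂ p ; (inj₂ (L , p)) → L , inj₁ p })

  spoke-dir : ∀ s {a L} (sp : Linked centre a L) → isDescendant sp ≡ s → Dir s centre a L
  spoke-dir true  (inj₁ p) _ = p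
  spoke-dir false (inj₂ p) _ = p

  dir-nonempty : ∀ s {a b L} → Dir s a b L → a ≢ b → 0 < L
  dir-nonempty s     {L = suc _} _ _   = s≤s z≤n
  dir-nonempty true  {L = zero}  p a≢b = ⊥-elim (a≢b (path-zero p))
  dir-nonempty false {L = zero}  p a≢b = ⊥-elim (a≢b (sym (path-zero p)))


  module SameSide (s : Bool) (same : ∀ i → descends i ≡ s) where

    R : Fin n → Fin n → Set
    R i j = DirReach s (V i) (V j)

    depthPath : ∀ i → Dir s centre (V i) (depth i)
    depthPath i = spoke-dir s (spokePath i) (same i)

    R⇒depth< : ∀ {i j} → i ≢ j → R i j → depth i < depth j
    R⇒depth< {i} {j} i≢j (L , p) =
      subst (depth i <_) (dir-length s (depthPath i) p (depthPath j))
            (m<m+n (depth i) (dir-nonempty s p (i≢j ∘ suc-injective ∘ f-injective)))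

    R-predecessors-comparable : ∀ {x y z} → R y x → R z x → R y z ⊎ R z y
    R-predecessors-comparable {y = y} {z} ry rz = dir-predecessors-comparable s ry rz (depthPath y) (depthPath z)

    adjacent⇔comparable×≉ : ∀ {i j} → i ≢ j → CycleAdj n i j ⇔ ((R i j ⊎ R j i) × ¬ i ≈ j)
    adjacent⇔comparable×≉ i≢j = mk⇔
      (map₁ (Equivalence.to (linked⇔dir s)) ∘ Equivalence.to (adjacent⇔linked×≉ i≢j))
      (Equivalence.from (adjacent⇔linked×≉ i≢j) ∘ map₁ (Equivalence.from (linked⇔dir s)))

    open TreeOrder ≈-sym ≈-trans (dir-trans s) depth R⇒depth< R-predecessors-comparable adjacent⇔comparable×≉ public

  module _ .{{_ : NonZero n}} (n≥7 : n ≥ 7) where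
    open Rim n

    ¬side-change-at : ∀ p → ¬ descends (rim p) ≢ descends (rim (suc p))
    ¬side-change-at p = SideChange.¬side-change ≈-sym ≈-trans descends adjacent⇒≉ opposite⇒≈ (rim-P₇Walk n≥7 p)

    ¬same-side : ∀ s → ¬ (∀ i → descends i ≡ s)
    ¬same-side s same with argmax-Fin depth (rim 0)
    ... | x , deepest with rim-hits 2 (≤-trans (s≤s (s≤s z≤n)) n≥7) x
    ...   | p , refl = ¬local-max (rim-P₇Walk n≥7 p) (deepest (rim (1 + p))) (deepest (rim (3 + p)))
      where open SameSide s same

proposition9p9 : (n : ℕ) → n ≥ 7 → ¬ IsWillow (WheelAdj n)
proposition9p9 n n≥7 (m , _ , k , A , f , (oriented , (_ , acyclic)) , f-injective , represents) =
  [ ¬same-side n≥7 (descends (rim 0)) , (λ (p , change) → ¬side-change-at n≥7 p change) ]′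
    (constant-or-change descends)
  where
  instance
    n≢0 : NonZero n
    n≢0 = >-nonZero (≤-trans (s≤s z≤n) n≥7)
  open Rim n
  open WheelWillow oriented acyclic f f-injective represents
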